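{- In a small step alternating pushdown system, every cut-free proof uses only introduction rules (every node of the proof is justified by an introduction rule).
   Context: Fix a language with finitely many unary predicate symbols (states), finitely many unary function symbols (stack symbols), a constant $\varepsilon$ and a variable $x$. Words are closed terms $\gamma_1(\cdots\gamma_n(\varepsilon))$, written $\gamma_1\cdots\gamma_n$; configurations are atomic propositions $P(w)$ with $P$ a state and $w$ a word. A proof of a configuration in a set of rules is a finite tree, each node labeled by a configuration and annotated by a rule $\frac{A_1\cdots A_n}{B}$ of the system and a substitution $\sigma$ of a word for $x$ such that the node is labeled $\sigma B$ and its children $\sigma A_1,\dots,\sigma A_n$. Rule types: an introduction rule is $\frac{P_1(x)\cdots P_n(x)}{Q(\gamma x)}$ ($\gamma$ a stack symbol, $n\ge0$) or $\frac{}{Q(\varepsilon)}$; an elimination rule is $\frac{P_1(\gamma x)\ P_2(x)\cdots P_n(x)}{Q(x)}$ ($n\ge1$); a neutral rule is $\frac{P_1(x)\cdots P_n(x)}{Q(x)}$ ($n\ge0$). A small step alternating pushdown system is a finite set of introduction, elimination and neutral rules. A cut is a (sub)proof of one of the following forms: (a) its root $R(w)$ is obtained by an elimination rule whose premise $Q_1(\gamma w)$ is obtained by an introduction rule; (b) its root $R(\gamma w)$ is obtained by a neutral rule all of whose premises $Q_1(\gamma w),\dots,Q_n(\gamma w)$ ($n\ge0$) are obtained by introduction rules; (c) its root $R(\varepsilon)$ is obtained by a neutral rule all of whose premises $Q_1(\varepsilon),\dots,Q_n(\varepsilon)$ ($n\ge0$) are obtained by introduction rules $\frac{}{Q_i(\varepsilon)}$.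 A proof is cut-free if none of its subproofs is a cut. -}

module Defs where

open import Data.Nat using (ℕ)
open import Data.Fin using (Fin)
open import Data.List using (List; []; _∷_)
open import Data.List.Membership.Propositional using (_∈_)
open import Data.List.Relation.Unary.All using (All; []; _∷_)
open import Data.Unit using (⊤)
open import Data.Empty using (⊥)
open import Relation.Nullary using (¬_)

-- A language with finitely many states (unary predicate symbols), given by
-- Fin nS, and finitely many stack symbols (unary function symbols), Fin nG.
module _ (nS nG : ℕ) where

  State : Set
  State = Fin nS

  Sym : Set
  Sym = Fin nG

  -- The closed term γ₁(⋯γₙ(ε)) is the list γ₁ ∷ ⋯ ∷ γₙ ∷ [].
  Word : Set
  Word = List Sym

  data Rule : Set where
    -- P₁(x) ⋯ Pₙ(x) / Q(γ x)     (n ≥ 0)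
    introPush : (Ps : List State) (Q : State) (γ : Sym) → Rule
    -- / Q(ε)
    introEps  : (Q : State) → Rule
    -- P₁(γ x) P₂(x) ⋯ Pₙ(x) / Q(x)   (n ≥ 1: P₁ is always present)
    elim      : (P₁ : State) (γ : Sym) (Ps : List State) (Q : State) → Rule
    -- P₁(x) ⋯ Pₙ(x) / Q(x)     (n ≥ 0)
    neutral   : (Ps : List State) (Q : State) → Rule

  System : Set
  System = List Rule

  data Proof (S : System) : State → Word → Set where
    byIntroPush : ∀ {Ps Q γ} (w : Word) → introPush Ps Q γ ∈ S →
                  All (λ P → Proof S P w) Ps → Proof S Q (γ ∷ w)
    byIntroEps  : ∀ {Q} → introEps Q ∈ S → Proof S Q []
    byElim      : ∀ {P₁ γ Ps Q} (w : Word) → elim P₁ γ Ps Q ∈ S →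
                  Proof S P₁ (γ ∷ w) → All (λ P → Proof S P w) Ps → Proof S Q w
    byNeutral   : ∀ {Ps Q} (w : Word) → neutral Ps Q ∈ S →
                  All (λ P → Proof S P w) Ps → Proof S Q w

  module _ {S : System} where

    ProofPred : Set₁
    ProofPred = ∀ {Q w} → Proof S Q w → Set

    data AllProofs (R : ProofPred) {w : Word} : {Ps : List State} →
                   All (λ P → Proof S P w) Ps → Set where
      []  : AllProofs R []
      _∷_ : ∀ {P Ps} {p : Proof S P w} {ps : All (λ P → Proof S P w) Ps} →
            R p → AllProofs R ps → AllProofs R (p ∷ ps)

    data Everywhere (R : ProofPred) : ProofPred where
      atIntroPush : ∀ {Ps Q γ w} {m : introPush Ps Q γ ∈ S}
                    {ps : All (λ P → Proof S P w) Ps} →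
                    R (byIntroPush w m ps) → AllProofs (Everywhere R) ps →
                    Everywhere R (byIntroPush w m ps)
      atIntroEps  : ∀ {Q} {m : introEps Q ∈ S} →
                    R (byIntroEps m) → Everywhere R (byIntroEps m)
      atElim      : ∀ {P₁ γ Ps Q w} {m : elim P₁ γ Ps Q ∈ S}
                    {p₁ : Proof S P₁ (γ ∷ w)} {ps : All (λ P → Proof S P w) Ps} →
                    R (byElim w m p₁ ps) → Everywhere R p₁ →
                    AllProofs (Everywhere R) ps →
                    Everywhere R (byElim w m p₁ ps)
      atNeutral   : ∀ {Ps Q w} {m : neutral Ps Q ∈ S}
                    {ps : All (λ P → Proof S P w) Ps} →
                    R (byNeutral w m ps) → AllProofs (Everywhere R) ps →
                    Everywhere R (byNeutral w m ps)

    IsIntro : ProofPred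
    IsIntro (byIntroPush _ _ _) = ⊤
    IsIntro (byIntroEps _)      = ⊤
    IsIntro (byElim _ _ _ _)    = ⊥
    IsIntro (byNeutral _ _ _)   = ⊥

    IsIntroEps : ProofPred
    IsIntroEps (byIntroPush _ _ _) = ⊥
    IsIntroEps (byIntroEps _)      = ⊤
    IsIntroEps (byElim _ _ _ _)    = ⊥
    IsIntroEps (byNeutral _ _ _)   = ⊥

    data IsCut : ProofPred where
      cutA : ∀ {P₁ γ Ps Q w} {m : elim P₁ γ Ps Q ∈ S} {p₁ : Proof S P₁ (γ ∷ w)}
             {ps : All (λ P → Proof S P w) Ps} →
             IsIntro p₁ → IsCut (byElim w m p₁ ps)
      cutB : ∀ {Ps Q γ w} {m : neutral Ps Q ∈ S}
             {ps : All (λ P → Proof S P (γ ∷ w)) Ps} →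
             AllProofs IsIntro ps → IsCut (byNeutral (γ ∷ w) m ps)
      cutC : ∀ {Ps Q} {m : neutral Ps Q ∈ S}
             {ps : All (λ P → Proof S P []) Ps} →
             AllProofs IsIntroEps ps → IsCut (byNeutral [] m ps)

    CutFree : ProofPred
    CutFree = Everywhere (λ p → ¬ IsCut p)

    OnlyIntro : ProofPred
    OnlyIntro = Everywhere IsIntro

module Submission where

-- Once the
-- immediate subproofs are known to consist only of introductions, their roots
-- are introductions, so a node justified by
--   * an elimination rule is a cut of form (a) (its principal premise is an
--     introduction);
--   * a neutral rule at a word γ w is a cut of form (b);
--   * a neutral rule at ε is a cut of form (c), because an introduction
--     concluding a configuration Q(ε) can only be a rule  / Q(ε).
-- All three contradict cut-freeness, leaving only introduction nodes.

open import Defs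
open import Data.Nat using (ℕ)
open import Data.List using ([]; _∷_)
open import Data.List.Relation.Unary.All using (All; []; _∷_)
open import Data.Unit using (tt)
open import Data.Empty using (⊥-elim)

module _ {nS nG : ℕ} {S : System nS nG} where

  everywhere-root : ∀ {R : ProofPred nS nG} {Q w} {p : Proof nS nG S Q w} →
                    Everywhere nS nG R p → R p
  everywhere-root (atIntroPush r _) = r
  everywhere-root (atIntroEps r)    = r
  everywhere-root (atElim r _ _)    = r
  everywhere-root (atNeutral r _)   = r

  allProofs-map : ∀ {R R′ : ProofPred nS nG} {w} →
                  (∀ {Q} {p : Proof nS nG S Q w} → R p → R′ p) →
                  ∀ {Ps} {ps : All (λ P → Proof nS nG S P w) Ps} →
                  AllProofs nS nG R ps → AllProofs nS nG R′ ps
  allProofs-map f []       = []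
  allProofs-map f (r ∷ rs) = f r ∷ allProofs-map f rs

  intro-at-ε : ∀ {Q} {p : Proof nS nG S Q []} →
               IsIntro nS nG p → IsIntroEps nS nG p
  intro-at-ε {p = byIntroEps _} _ = tt

  mutual
    cutFree⇒onlyIntro : ∀ {Q w} (p : Proof nS nG S Q w) →
                        CutFree nS nG p → OnlyIntro nS nG p
    cutFree⇒onlyIntro (byIntroPush w m ps) (atIntroPush _ cfs) =
      atIntroPush tt (cutFree⇒onlyIntro* ps cfs)
    cutFree⇒onlyIntro (byIntroEps m) (atIntroEps _) = atIntroEps tt
    cutFree⇒onlyIntro (byElim w m p₁ ps) (atElim ¬cut cf₁ _) =
      ⊥-elim (¬cut (cutA (everywhere-root (cutFree⇒onlyIntro p₁ cf₁))))
    cutFree⇒onlyIntro (byNeutral [] m ps) (atNeutral ¬cut cfs) =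
      ⊥-elim (¬cut (cutC (allProofs-map (λ o → intro-at-ε (everywhere-root o))
                                        (cutFree⇒onlyIntro* ps cfs))))
    cutFree⇒onlyIntro (byNeutral (γ ∷ w) m ps) (atNeutral ¬cut cfs) =
      ⊥-elim (¬cut (cutB (allProofs-map everywhere-root
                                        (cutFree⇒onlyIntro* ps cfs))))

    cutFree⇒onlyIntro* : ∀ {w Ps} (ps : All (λ P → Proof nS nG S P w) Ps) →
                         AllProofs nS nG (CutFree nS nG) ps →
                         AllProofs nS nG (OnlyIntro nS nG) ps
    cutFree⇒onlyIntro* []       []         = []
    cutFree⇒onlyIntro* (p ∷ ps) (cf ∷ cfs) =
      cutFree⇒onlyIntro p cf ∷ cutFree⇒onlyIntro* ps cfs

lemma5 : (nS nG : ℕ) (S : System nS nG) (Q : State nS nG) (w : Word nS nG)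
         (p : Proof nS nG S Q w) →
         CutFree nS nG p → OnlyIntro nS nG p
lemma5 nS nG S Q w p = cutFree⇒onlyIntro p
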